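{- Let $G$ be a simple undirected graph with $n$ vertices ($n\in\mathbb{N}$) having at most one non-trivial connected component. Then $G$ is Eulerian if and only if $\sum_{e\in\beta(G,n)}e=\mathbf{0}$ for every coding sequence $\beta(G,n)$ of $G$.
   Context: Coding sequences: for a simple graph $G=(V,E)$ with $n$ vertices, choose a labeling $V=\{v_0,\ldots,v_{n-1}\}$. For an edge $e=v_iv_j$ with $i>j$ let $f^\#(e)=(x_1,\ldots,x_{n-1})\in\mathbb{Z}_2^{n-1}$ with $x_k=1$ iff $n-i\le k\le n-j-1$ and $x_k=0$ otherwise. The coding sequence $\beta(G,n)$ for that labeling is the set $\{f^\#(e):e\in E\}$. A non-trivial component is one containing at least one edge. -}

module Defs where

open import Data.Nat using (ℕ; zero; suc; _∸_; _≤ᵇ_; _<ᵇ_)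
open import Data.Bool using (Bool; true; false; _∧_; _xor_; if_then_else_)
open import Data.Fin using (Fin; toℕ)
open import Data.Fin.Properties using () renaming (_≟_ to _≟ᶠ_)
open import Data.Fin.Permutation using (Permutation′; _⟨$⟩ʳ_)
open import Data.List using (List; []; _∷_; foldr; concatMap; length; filter; allFin)
open import Data.Product using (Σ; _×_; _,_)
open import Data.Sum using (_⊎_)
open import Relation.Nullary.Decidable using (⌊_⌋; _×-dec_; _⊎-dec_)
open import Relation.Binary.PropositionalEquality using (_≡_)

record Graph (n : ℕ) : Set where
  field
    adj    : Fin n → Fin n → Bool
    sym    : ∀ u v → adj u v ≡ adj v u
    irrefl : ∀ v → adj v v ≡ false
open Graph public

module _ {n : ℕ} (G : Graph n) where

  data Reachable : Fin n → Fin n → Set where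
    here : ∀ {u} → Reachable u u
    step : ∀ {u v w} → adj G u v ≡ true → Reachable v w → Reachable u w

  AtMostOneNontrivialComponent : Set
  AtMostOneNontrivialComponent =
    ∀ u v x y → adj G u v ≡ true → adj G x y ≡ true → Reachable u x

  -- darts (oriented edges) and walks given as lists of darts
  Dart : Set
  Dart = Fin n × Fin n

  Walk : Fin n → List Dart → Fin n → Set
  Walk a []             b = a ≡ b
  Walk a ((u , v) ∷ ds) b = (u ≡ a) × (adj G u v ≡ true) × Walk v ds b

  Closed : List Dart → Set
  Closed ds = (ds ≡ []) ⊎ Σ (Fin n) (λ a → Walk a ds a)

  onEdge : Fin n → Fin n → Dart → Bool
  onEdge u v (x , y) = ⌊ ((x ≟ᶠ u) ×-dec (y ≟ᶠ v)) ⊎-dec ((x ≟ᶠ v) ×-dec (y ≟ᶠ u)) ⌋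

  uses : Fin n → Fin n → List Dart → ℕ
  uses u v ds = length (filter (λ d → onEdge u v d ≟ᵇ true) ds)
    where
      open import Data.Bool.Properties using () renaming (_≟_ to _≟ᵇ_)

  -- G is Eulerian: it has an Eulerian circuit, i.e. a closed walk
  -- traversing every edge exactly once (only edges of G can be traversed).
  Eulerian : Set
  Eulerian = Σ (List Dart) λ ds → Closed ds × (∀ u v → adj G u v ≡ true → uses u v ds ≡ 1)

-- f#(v_i v_j) for i > j, coordinate k ∈ {1,…,n-1} encoded as c : Fin (n ∸ 1), k = toℕ c + 1:
-- x_k = 1 iff n - i ≤ k ≤ n - j - 1
code : (n i j : ℕ) → Fin (n ∸ 1) → Bool
code n i j c = (n ∸ i ≤ᵇ k) ∧ (k ≤ᵇ n ∸ j ∸ 1)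
  where k = suc (toℕ c)

-- Labeling: the permutation π sends vertex u to its label index, i.e. u = v_{π u}.
-- Sum in Z₂^{n-1} of the coding sequence β(G,n) for that labeling:
-- each edge {u,v} counted once, via the orientation with label u > label v.
-- (f# is injective on edges, so summing over the set β equals summing over E.)
codingSum : {n : ℕ} → Graph n → Permutation′ n → Fin (n ∸ 1) → Bool
codingSum {n} G π c =
  foldr _xor_ false
    (concatMap (λ u → concatMap (λ v →
        (if adj G u v ∧ (toℕ (π ⟨$⟩ʳ v) <ᵇ toℕ (π ⟨$⟩ʳ u))
          then code n (toℕ (π ⟨$⟩ʳ u)) (toℕ (π ⟨$⟩ʳ v)) c
          else false) ∷ []) (allFin n)) (allFin n))

SumZero : {n : ℕ} → Graph n → Permutation′ n → Set
SumZero {n} G π = ∀ (c : Fin (n ∸ 1)) → codingSum G π c ≡ false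

module Submission where

-- For a labelling π and an edge with labels j < i, the coding vector has
-- x_k = 1 iff j < n-k ≤ i: the edge crosses the cut between the vertices
-- labelled below the threshold n-k and the others.  So coordinate k of the sum
-- of β(G,n) is the parity of that cut (codingSum≡oddCut), which by the handshake
-- lemma for cuts (oddCut-handshake) is the parity of the total degree below the
-- threshold.  Hence even degrees give zero sums (evenDegrees⇒sumZero), and,
-- labelling a vertex w by 0 and reading coordinate n-1, zero sums give even
-- degree at w (sumZero⇒evenDegrees).  A closed walk has even degree at every
-- vertex (eulerian⇒evenDegrees).  Conversely, Hierholzer's procedure (extract)
-- turns a list of all edges with even degrees into a closed walk whose unused
-- remainder avoids every vertex of the walk; as the edges form a single
-- component, the walk already traverses every edge (circuit).

open import Defs renaming (sym to adj-sym)
open import Data.Nat using (ℕ; zero; suc; _+_; _∸_; _≤_; _<_; _≤ᵇ_; _<ᵇ_; s≤s⁻¹)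
open import Data.Nat.Properties
  using ( +-assoc; +-comm; +-identityʳ; +-monoʳ-≤; ≤-refl; ≤-reflexive; ≤-trans; n≤1+n; <-≤-trans; <-asym; <-cmp
        ; <⇒≱; ≮⇒≥; <ᵇ⇒<; <⇒<ᵇ; _≤?_; _<?_; m∸n≤m; m+n∸n≡m; m+n≡0⇒n≡0; ∸-+-assoc
        ; m≤n+o⇒m∸n≤o; m≤n+m∸n; m+n≤o⇒m≤o∸n; m≤o∸n⇒m+n≤o )
open import Data.Nat.Tactic.RingSolver using (solve-∀)
open import Data.Bool using (Bool; true; false; _∧_; _∨_; _xor_; not; if_then_else_; T)
open import Data.Bool.Properties
  using ( xor-∧-commutativeRing; xor-assoc; xor-same; xor-identityʳ; ∧-zeroʳ; ∧-comm; ∨-comm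
        ; not-injective; not-involutive; T-∧ ) renaming (_≟_ to _≟ᵇ_)
open import Algebra.Bundles using (CommutativeRing)
open import Algebra.Properties.Semiring.Sum (CommutativeRing.semiring xor-∧-commutativeRing)
  using (sum-syntax; sum-cong-≗; sum-replicate-zero; ∑-comm; ∑-distrib-+; *-distribˡ-sum)
open import Data.Fin using (Fin; zero; suc; toℕ; fromℕ; _≟_)
open import Data.Fin.Properties using (toℕ<n; toℕ-fromℕ; toℕ-injective)
open import Data.Fin.Permutation using (Permutation′; _⟨$⟩ʳ_; _⟨$⟩ˡ_; inverseˡ; transpose)
open import Data.List using (List; []; _∷_; _++_; foldr; concatMap; length; filter; filterᵇ; allFin; tabulate; cartesianProduct)
open import Data.List.Properties using (filter-accept; filter-reject; filter-none)
open import Data.List.Membership.Propositional using (_∈_)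
open import Data.List.Membership.Propositional.Properties using (∈-filter⁺; ∈-filter⁻; ∈-cartesianProduct⁺; ∈-allFin)
open import Data.List.Relation.Unary.All as All using (All; []; _∷_)
open import Data.List.Relation.Unary.All.Properties using (all-filter)
open import Data.List.Relation.Unary.Any using (Any; here; there)
import Data.List.Relation.Unary.Any.Properties as Any
open import Data.List.Relation.Unary.Unique.Propositional using (Unique; _∷_)
open import Data.List.Relation.Unary.Unique.Propositional.Properties using (allFin⁺; cartesianProduct⁺; filter⁺)
open import Data.Product using (_×_; _,_; proj₁; proj₂)
open import Data.Sum using (_⊎_; inj₁; inj₂)
open import Data.Empty using (⊥; ⊥-elim)
open import Function using (_⇔_; mk⇔; Equivalence; _∘_)
open import Relation.Nullary using (Dec; yes; no; ¬_; does; ¬?; _×-dec_; _⊎-dec_; contradiction)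
open import Relation.Nullary.Decidable using (isYes; isYes≗does; does-⇔; dec-true; T?)
open import Relation.Unary using (Decidable)
open import Relation.Binary using (tri<; tri≈; tri>)
open import Relation.Binary.PropositionalEquality

infix 4 _≡ᵇ_
_≡ᵇ_ : ∀ {n} → Fin n → Fin n → Bool
x ≡ᵇ y = does (x ≟ y)

≡ᵇ-sym : ∀ {n} (x y : Fin n) → (x ≡ᵇ y) ≡ (y ≡ᵇ x)
≡ᵇ-sym x y = does-⇔ (mk⇔ sym sym) (x ≟ y) (y ≟ x)

≡ᵇ-sound : ∀ {n} {x y : Fin n} → (x ≡ᵇ y) ≡ true → x ≡ y
≡ᵇ-sound {x = x} {y} eq with x ≟ y
... | yes x≡y = x≡y

≡ᵇ-permute : ∀ {n} (π : Permutation′ n) v w → (π ⟨$⟩ʳ v ≡ᵇ π ⟨$⟩ʳ w) ≡ (v ≡ᵇ w)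
≡ᵇ-permute π v w = does-⇔ (mk⇔ injective (cong (π ⟨$⟩ʳ_))) ((π ⟨$⟩ʳ v) ≟ (π ⟨$⟩ʳ w)) (v ≟ w)
  where
  injective : π ⟨$⟩ʳ v ≡ π ⟨$⟩ʳ w → v ≡ w
  injective eq = trans (sym (inverseˡ π)) (trans (cong (π ⟨$⟩ˡ_) eq) (inverseˡ π))

-- Sums ∑ are taken in ℤ₂ = (Bool, xor, ∧), using the library's semiring sums.

∑-select : ∀ {n} (f : Fin n → Bool) (w : Fin n) → ∑[ v < n ] (f v ∧ (v ≡ᵇ w)) ≡ f w
∑-select {suc n} f zero = begin
    f zero ∧ true xor ∑[ v < n ] (f (suc v) ∧ false)
  ≡⟨ cong₂ _xor_ (∧-comm (f zero) true) (sum-cong-≗ (λ v → ∧-zeroʳ (f (suc v)))) ⟩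
    f zero xor ∑[ v < n ] false
  ≡⟨ cong (f zero xor_) (sum-replicate-zero n) ⟩
    f zero xor false
  ≡⟨ xor-identityʳ (f zero) ⟩
    f zero
  ∎
  where open ≡-Reasoning
∑-select {suc n} f (suc w) =
  trans (cong (_xor ∑[ v < n ] (f (suc v) ∧ (v ≡ᵇ w))) (∧-zeroʳ (f zero)))
        (∑-select (λ v → f (suc v)) w)

-- Over ℤ₂ a symmetric double sum with vanishing diagonal is zero:
-- the terms f u v and f v u cancel in pairs.
∑∑-symmetric : ∀ {n} (f : Fin n → Fin n → Bool) →
  (∀ u v → f u v ≡ f v u) → (∀ u → f u u ≡ false) →
  ∑[ u < n ] ∑[ v < n ] f u v ≡ false
∑∑-symmetric {zero} f symm diag = refl
∑∑-symmetric {suc n} f symm diag = begin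
    (f zero zero xor row) xor ∑[ u < n ] (f (suc u) zero xor ∑[ v < n ] f (suc u) (suc v))
  ≡⟨ cong₂ (λ a b → (a xor row) xor b) (diag zero) (∑-distrib-+ (λ u → f (suc u) zero) _) ⟩
    row xor (column xor rest)
  ≡⟨ cong (λ z → row xor (z xor rest)) (sum-cong-≗ (λ u → symm (suc u) zero)) ⟩
    row xor (row xor rest)
  ≡⟨ trans (sym (xor-assoc row row rest)) (cong (_xor rest) (xor-same row)) ⟩
    rest
  ≡⟨ ∑∑-symmetric (λ u v → f (suc u) (suc v)) (λ u v → symm (suc u) (suc v)) (λ u → diag (suc u)) ⟩
    false
  ∎
  where
  open ≡-Reasoning
  row    = ∑[ v < n ] f zero (suc v)
  column = ∑[ u < n ] f (suc u) zero
  rest   = ∑[ u < n ] ∑[ v < n ] f (suc u) (suc v)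

xorAll-++ : ∀ xs ys → foldr _xor_ false (xs ++ ys) ≡ foldr _xor_ false xs xor foldr _xor_ false ys
xorAll-++ []       ys = refl
xorAll-++ (x ∷ xs) ys = trans (cong (x xor_) (xorAll-++ xs ys)) (sym (xor-assoc x _ _))

xorAll-concatMap : ∀ {A : Set} {m} (g : A → List Bool) (h : Fin m → A) →
  foldr _xor_ false (concatMap g (tabulate h)) ≡ ∑[ i < m ] foldr _xor_ false (g (h i))
xorAll-concatMap {m = zero}  g h = refl
xorAll-concatMap {m = suc m} g h =
  trans (xorAll-++ (g (h zero)) _) (cong (foldr _xor_ false (g (h zero)) xor_) (xorAll-concatMap g (λ i → h (suc i))))

bit : Bool → ℕ
bit false = 0
bit true  = 1

parity : ℕ → Bool
parity zero    = false
parity (suc k) = not (parity k)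

parity-bit+ : ∀ b k → parity (bit b + k) ≡ b xor parity k
parity-bit+ false k = refl
parity-bit+ true  k = refl

xor-cancelˡ : ∀ p q r d → (p xor q) xor d ≡ p xor r → d ≡ q xor r
xor-cancelˡ false false r d eq = eq
xor-cancelˡ false true  r d eq = trans (sym (not-involutive d)) (cong not eq)
xor-cancelˡ true  false r d eq = not-injective eq
xor-cancelˡ true  true  r d eq = eq

module _ {n : ℕ} (G : Graph n) where

  oddDegree : Fin n → Bool
  oddDegree w = ∑[ v < n ] adj G w v

  oddCut : (Fin n → Bool) → Bool
  oddCut S = ∑[ u < n ] ∑[ v < n ] (adj G u v ∧ (not (S u) ∧ S v))

  -- Handshake lemma for cuts: the edges leaving S have the parity of the
  -- total degree of S, since the edges inside S are counted twice.
  oddCut-handshake : ∀ S → oddCut S ≡ ∑[ v < n ] (S v ∧ oddDegree v)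
  oddCut-handshake S = begin
      ∑[ u < n ] ∑[ v < n ] (adj G u v ∧ (not (S u) ∧ S v))
    ≡⟨ sum-cong-≗ (λ u → trans (sum-cong-≗ (λ v → split (adj G u v) (S u) (S v)))
                               (∑-distrib-+ (λ v → adj G u v ∧ S v) (inside u))) ⟩
      ∑[ u < n ] (∑[ v < n ] (adj G u v ∧ S v) xor ∑[ v < n ] inside u v)
    ≡⟨ ∑-distrib-+ (λ u → ∑[ v < n ] (adj G u v ∧ S v)) (λ u → ∑[ v < n ] inside u v) ⟩
      ∑[ u < n ] ∑[ v < n ] (adj G u v ∧ S v) xor ∑[ u < n ] ∑[ v < n ] inside u v
    ≡⟨ cong₂ _xor_ (∑-comm (λ u v → adj G u v ∧ S v)) (∑∑-symmetric inside inside-sym inside-diag) ⟩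
      ∑[ v < n ] ∑[ u < n ] (adj G u v ∧ S v) xor false
    ≡⟨ xor-identityʳ _ ⟩
      ∑[ v < n ] ∑[ u < n ] (adj G u v ∧ S v)
    ≡⟨ sum-cong-≗ (λ v → sym (degree-term v)) ⟩
      ∑[ v < n ] (S v ∧ oddDegree v)
    ∎
    where
    open ≡-Reasoning
    inside : Fin n → Fin n → Bool
    inside u v = S u ∧ (adj G u v ∧ S v)

    split : ∀ a s t → a ∧ (not s ∧ t) ≡ (a ∧ t) xor (s ∧ (a ∧ t))
    split a true  t = trans (∧-zeroʳ a) (sym (xor-same (a ∧ t)))
    split a false t = sym (xor-identityʳ (a ∧ t))

    inside-sym : ∀ u v → inside u v ≡ inside v u
    inside-sym u v rewrite adj-sym G u v with S u | S v
    ... | true  | true  = refl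
    ... | true  | false = ∧-zeroʳ _
    ... | false | true  = sym (∧-zeroʳ _)
    ... | false | false = refl

    inside-diag : ∀ u → inside u u ≡ false
    inside-diag u rewrite irrefl G u = ∧-zeroʳ (S u)

    degree-term : ∀ v → S v ∧ oddDegree v ≡ ∑[ u < n ] (adj G u v ∧ S v)
    degree-term v = trans (*-distribˡ-sum (S v) (adj G v))
      (sum-cong-≗ (λ u → trans (∧-comm (S v) (adj G v u)) (cong (_∧ S v) (adj-sym G v u))))

  oddCut-cong : ∀ {S S′} → (∀ v → S v ≡ S′ v) → oddCut S ≡ oddCut S′
  oddCut-cong S≗S′ = sum-cong-≗ (λ u → sum-cong-≗ (λ v →
    cong₂ (λ a b → adj G u v ∧ (not a ∧ b)) (S≗S′ u) (S≗S′ v)))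

  even⇒evenCuts : (∀ v → oddDegree v ≡ false) → ∀ S → oddCut S ≡ false
  even⇒evenCuts even S = begin
      oddCut S
    ≡⟨ oddCut-handshake S ⟩
      ∑[ v < n ] (S v ∧ oddDegree v)
    ≡⟨ sum-cong-≗ (λ v → trans (cong (S v ∧_) (even v)) (∧-zeroʳ (S v))) ⟩
      ∑[ v < n ] false
    ≡⟨ sum-replicate-zero n ⟩
      false
    ∎
    where open ≡-Reasoning

  oddCut-singleton : ∀ w → oddCut (_≡ᵇ w) ≡ oddDegree w
  oddCut-singleton w = trans (oddCut-handshake (_≡ᵇ w))
    (trans (sum-cong-≗ (λ v → ∧-comm (v ≡ᵇ w) (oddDegree v))) (∑-select oddDegree w))

-- For an edge with labels j < i and a
-- coordinate k ∈ {1,…,n}, the entry x_k = [n-i ≤ k ≤ n-j-1] is 1 exactly when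
-- the threshold n-k separates the labels: j < n-k ≤ i.

∸-≤-swap : ∀ n a b → n ∸ a ≤ b → n ∸ b ≤ a
∸-≤-swap n a b h = m≤n+o⇒m∸n≤o n b
  (≤-trans (m≤n+m∸n n a) (≤-trans (+-monoʳ-≤ a h) (≤-reflexive (+-comm a b))))

≤-∸-swap : ∀ n a b → b ≤ n → a ≤ n ∸ b → b ≤ n ∸ a
≤-∸-swap n a b b≤n h = m+n≤o⇒m≤o∸n b (≤-trans (≤-reflexive (+-comm b a)) (m≤o∸n⇒m+n≤o a b≤n h))

lower-condition : ∀ n i k → (n ∸ i ≤ᵇ k) ≡ not (i <ᵇ n ∸ k)
lower-condition n i k = does-⇔ equiv (n ∸ i ≤? k) (¬? (i <? n ∸ k))
  where
  equiv : (n ∸ i ≤ k) ⇔ (¬ i < n ∸ k)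
  equiv = mk⇔ (λ h i<n∸k → <⇒≱ i<n∸k (∸-≤-swap n i k h)) (λ h → ∸-≤-swap n k i (≮⇒≥ h))

upper-condition : ∀ n j k → j < n → k ≤ n → (k ≤ᵇ n ∸ j ∸ 1) ≡ (j <ᵇ n ∸ k)
upper-condition n j k j<n k≤n = does-⇔ equiv (k ≤? n ∸ j ∸ 1) (j <? n ∸ k)
  where
  n∸j∸1 : n ∸ j ∸ 1 ≡ n ∸ suc j
  n∸j∸1 = trans (∸-+-assoc n j 1) (cong (n ∸_) (+-comm j 1))
  equiv : (k ≤ n ∸ j ∸ 1) ⇔ (j < n ∸ k)
  equiv = mk⇔ (λ h → ≤-∸-swap n k (suc j) j<n (subst (k ≤_) n∸j∸1 h))
              (λ h → subst (k ≤_) (sym n∸j∸1) (≤-∸-swap n (suc j) k k≤n h))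

separated⇒ordered : ∀ i j t → T (not (i <ᵇ t) ∧ (j <ᵇ t)) → T (j <ᵇ i)
separated⇒ordered i j t h with i <ᵇ t in i-below | j <ᵇ t in j-below
... | false | true = <⇒<ᵇ (<-≤-trans (<ᵇ⇒< j t (subst T (sym j-below) _))
                                     (≮⇒≥ (λ i<t → subst T i-below (<⇒<ᵇ i<t))))

if-implied : ∀ b x → (T x → T b) → (if b then x else false) ≡ x
if-implied true  x       _   = refl
if-implied false false   _   = refl
if-implied false true    x⇒b = ⊥-elim (x⇒b _)

coding-entry : ∀ n i j k → j < n → k ≤ n →
  (if j <ᵇ i then (n ∸ i ≤ᵇ k) ∧ (k ≤ᵇ n ∸ j ∸ 1) else false) ≡ not (i <ᵇ n ∸ k) ∧ (j <ᵇ n ∸ k)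
coding-entry n i j k j<n k≤n rewrite lower-condition n i k | upper-condition n j k j<n k≤n =
  if-implied (j <ᵇ i) _ (separated⇒ordered i j (n ∸ k))

below-one : ∀ {m} (x : Fin (suc m)) → (toℕ x <ᵇ 1) ≡ (x ≡ᵇ zero)
below-one zero    = refl
below-one (suc x) = refl

module _ {n : ℕ} (G : Graph n) where

  -- Under labelling π, coordinate c of the coding sum tests whether a label
  -- lies below the threshold n - k, where k = c + 1.
  belowThreshold : Permutation′ n → Fin (n ∸ 1) → Fin n → Bool
  belowThreshold π c v = toℕ (π ⟨$⟩ʳ v) <ᵇ n ∸ suc (toℕ c)

  codingSum≡oddCut : ∀ π c → codingSum G π c ≡ oddCut G (belowThreshold π c)
  codingSum≡oddCut π c =
    trans (xorAll-concatMap row (λ u → u))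
      (sum-cong-≗ (λ u → trans (xorAll-concatMap (λ v → term u v ∷ []) (λ v → v)) (sum-cong-≗ (entry u))))
    where
    k≤n : suc (toℕ c) ≤ n
    k≤n = ≤-trans (toℕ<n c) (m∸n≤m n 1)
    label : Fin n → ℕ
    label v = toℕ (π ⟨$⟩ʳ v)
    term : Fin n → Fin n → Bool
    term u v = if adj G u v ∧ (label v <ᵇ label u) then code n (label u) (label v) c else false
    row : Fin n → List Bool
    row u = concatMap (λ v → term u v ∷ []) (allFin n)
    entry : ∀ u v → term u v xor false ≡ adj G u v ∧ (not (belowThreshold π c u) ∧ belowThreshold π c v)
    entry u v with adj G u v
    ... | false = refl
    ... | true  = trans (xor-identityʳ _)
                    (coding-entry n (label u) (label v) (suc (toℕ c)) (toℕ<n (π ⟨$⟩ʳ v)) k≤n)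

  evenDegrees⇒sumZero : (∀ v → oddDegree G v ≡ false) → ∀ π → SumZero G π
  evenDegrees⇒sumZero even π c =
    trans (codingSum≡oddCut π c) (even⇒evenCuts G even (belowThreshold π c))

-- Conversely, labelling w by 0 and reading coordinate k = n - 1 isolates
-- the cut around w, whose parity is the degree parity of w.
sumZero⇒evenDegrees : ∀ {n} (G : Graph n) → (∀ π → SumZero G π) → ∀ w → oddDegree G w ≡ false
sumZero⇒evenDegrees {suc zero} G _ zero = cong (_xor false) (irrefl G zero)
sumZero⇒evenDegrees {suc (suc m)} G zeroSums w = begin
    oddDegree G w
  ≡⟨ sym (oddCut-singleton G w) ⟩
    oddCut G (_≡ᵇ w)
  ≡⟨ oddCut-cong G (λ v → sym (threshold-isolates v)) ⟩
    oddCut G (belowThreshold G π (fromℕ m))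
  ≡⟨ sym (codingSum≡oddCut G π (fromℕ m)) ⟩
    codingSum G π (fromℕ m)
  ≡⟨ zeroSums π (fromℕ m) ⟩
    false
  ∎
  where
  open ≡-Reasoning
  π : Permutation′ (suc (suc m))
  π = transpose w zero
  πw≡0 : π ⟨$⟩ʳ w ≡ zero
  πw≡0 rewrite dec-true (w ≟ w) refl = refl
  threshold-isolates : ∀ v → belowThreshold G π (fromℕ m) v ≡ (v ≡ᵇ w)
  threshold-isolates v = begin
      toℕ (π ⟨$⟩ʳ v) <ᵇ suc m ∸ toℕ (fromℕ m)
    ≡⟨ cong (λ t → toℕ (π ⟨$⟩ʳ v) <ᵇ suc m ∸ t) (toℕ-fromℕ m) ⟩
      toℕ (π ⟨$⟩ʳ v) <ᵇ suc m ∸ m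
    ≡⟨ cong (toℕ (π ⟨$⟩ʳ v) <ᵇ_) (m+n∸n≡m 1 m) ⟩
      toℕ (π ⟨$⟩ʳ v) <ᵇ 1
    ≡⟨ below-one (π ⟨$⟩ʳ v) ⟩
      π ⟨$⟩ʳ v ≡ᵇ zero
    ≡⟨ cong ((π ⟨$⟩ʳ v) ≡ᵇ_) (sym πw≡0) ⟩
      π ⟨$⟩ʳ v ≡ᵇ π ⟨$⟩ʳ w
    ≡⟨ ≡ᵇ-permute π v w ⟩
      v ≡ᵇ w
    ∎

module _ {n : ℕ} (G : Graph n) where

  EdgeDarts : List (Dart G) → Set
  EdgeDarts = All (λ d → adj G (proj₁ d) (proj₂ d) ≡ true)

  EachEdgeOnce : List (Dart G) → Set
  EachEdgeOnce L = EdgeDarts L × (∀ u v → adj G u v ≡ true → uses G u v L ≡ 1)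

  onEdge-spec : ∀ u v x y → onEdge G u v (x , y) ≡ ((x ≡ᵇ u) ∧ (y ≡ᵇ v)) ∨ ((x ≡ᵇ v) ∧ (y ≡ᵇ u))
  onEdge-spec u v x y = isYes≗does _

  onEdge-self : ∀ u v → onEdge G u v (u , v) ≡ true
  onEdge-self u v = trans (onEdge-spec u v u v)
    (cong₂ (λ a b → (a ∧ b) ∨ ((u ≡ᵇ v) ∧ (v ≡ᵇ u))) (dec-true (u ≟ u) refl) (dec-true (v ≟ v) refl))

  onEdge-sym : ∀ u v d → onEdge G u v d ≡ onEdge G v u d
  onEdge-sym u v (x , y) = trans (onEdge-spec u v x y)
    (trans (∨-comm ((x ≡ᵇ u) ∧ (y ≡ᵇ v)) ((x ≡ᵇ v) ∧ (y ≡ᵇ u))) (sym (onEdge-spec v u x y)))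

  onEdge-reverse : ∀ u v x y → onEdge G u v (x , y) ≡ onEdge G u v (y , x)
  onEdge-reverse u v x y = trans (onEdge-spec u v x y)
    (trans (cong₂ _∨_ (∧-comm (x ≡ᵇ u) (y ≡ᵇ v)) (∧-comm (x ≡ᵇ v) (y ≡ᵇ u)))
      (trans (∨-comm ((y ≡ᵇ v) ∧ (x ≡ᵇ u)) ((y ≡ᵇ u) ∧ (x ≡ᵇ v))) (sym (onEdge-spec u v y x))))

  onEdge-cases : ∀ u v x y → onEdge G u v (x , y) ≡ true → (x ≡ u × y ≡ v) ⊎ (x ≡ v × y ≡ u)
  onEdge-cases u v x y = decide ((x ≟ u) ×-dec (y ≟ v)) ((x ≟ v) ×-dec (y ≟ u))
    where
    decide : ∀ {P Q : Set} (p? : Dec P) (q? : Dec Q) → isYes (p? ⊎-dec q?) ≡ true → P ⊎ Q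
    decide (yes p) _       _ = inj₁ p
    decide (no _)  (yes q) _ = inj₂ q
    decide (no _)  (no _)  ()

  onEdge-endpoint : ∀ u v x y → onEdge G u v (x , y) ≡ true → (x ≡ u) ⊎ (y ≡ u)
  onEdge-endpoint u v x y on with onEdge-cases u v x y on
  ... | inj₁ (x≡u , _) = inj₁ x≡u
  ... | inj₂ (_ , y≡u) = inj₂ y≡u

  onEdge-adj : ∀ u v x y → onEdge G u v (x , y) ≡ true → adj G x y ≡ true → adj G u v ≡ true
  onEdge-adj u v x y on xy with onEdge-cases u v x y on
  ... | inj₁ (refl , refl) = xy
  ... | inj₂ (refl , refl) = trans (adj-sym G u v) xy

  uses-∷ : ∀ u v d L → uses G u v (d ∷ L) ≡ bit (onEdge G u v d) + uses G u v L
  uses-∷ u v d L with onEdge G u v d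
  ... | true  = refl
  ... | false = refl

  uses-++ : ∀ u v L M → uses G u v (L ++ M) ≡ uses G u v L + uses G u v M
  uses-++ u v []      M = refl
  uses-++ u v (d ∷ L) M = begin
      uses G u v (d ∷ L ++ M)
    ≡⟨ uses-∷ u v d (L ++ M) ⟩
      bit (onEdge G u v d) + uses G u v (L ++ M)
    ≡⟨ cong (bit (onEdge G u v d) +_) (uses-++ u v L M) ⟩
      bit (onEdge G u v d) + (uses G u v L + uses G u v M)
    ≡⟨ sym (+-assoc (bit (onEdge G u v d)) _ _) ⟩
      (bit (onEdge G u v d) + uses G u v L) + uses G u v M
    ≡⟨ cong (_+ uses G u v M) (sym (uses-∷ u v d L)) ⟩
      uses G u v (d ∷ L) + uses G u v M
    ∎
    where open ≡-Reasoning

  uses-sym : ∀ u v L → uses G u v L ≡ uses G v u L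
  uses-sym u v []      = refl
  uses-sym u v (d ∷ L) = begin
      uses G u v (d ∷ L)
    ≡⟨ uses-∷ u v d L ⟩
      bit (onEdge G u v d) + uses G u v L
    ≡⟨ cong₂ (λ b k → bit b + k) (onEdge-sym u v d) (uses-sym u v L) ⟩
      bit (onEdge G v u d) + uses G v u L
    ≡⟨ sym (uses-∷ v u d L) ⟩
      uses G v u (d ∷ L)
    ∎
    where open ≡-Reasoning

  uses-nonedge : ∀ u v L → EdgeDarts L → adj G u v ≡ false → uses G u v L ≡ 0
  uses-nonedge u v []            []         _     = refl
  uses-nonedge u v ((x , y) ∷ L) (xy ∷ edges) uv≢ with onEdge G u v (x , y) in on
  ... | true  with () ← trans (sym uv≢) (onEdge-adj u v x y on xy)
  ... | false = uses-nonedge u v L edges uv≢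

  oddDegreeIn : List (Dart G) → Fin n → Bool
  oddDegreeIn []            w = false
  oddDegreeIn ((x , y) ∷ L) w = ((x ≡ᵇ w) xor (y ≡ᵇ w)) xor oddDegreeIn L w

  -- Along a walk from a to b the inner visits contribute two dart-ends each,
  -- so only the two ends of the walk can have odd degree.
  walk-oddDegreeIn : ∀ {a b} L → Walk G a L b → ∀ w → oddDegreeIn L w ≡ (a ≡ᵇ w) xor (b ≡ᵇ w)
  walk-oddDegreeIn {a} []            refl                 w = sym (xor-same (a ≡ᵇ w))
  walk-oddDegreeIn {b = b} ((x , y) ∷ L) (refl , _ , walk) w =
    trans (cong (((x ≡ᵇ w) xor (y ≡ᵇ w)) xor_) (walk-oddDegreeIn L walk w))
          (telescope (x ≡ᵇ w) (y ≡ᵇ w) (b ≡ᵇ w))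
    where
    telescope : ∀ p q r → (p xor q) xor (q xor r) ≡ p xor r
    telescope p q r = begin
        (p xor q) xor (q xor r)
      ≡⟨ xor-assoc p q (q xor r) ⟩
        p xor (q xor (q xor r))
      ≡⟨ cong (p xor_) (sym (xor-assoc q q r)) ⟩
        p xor ((q xor q) xor r)
      ≡⟨ cong (λ z → p xor (z xor r)) (xor-same q) ⟩
        p xor r
      ∎
      where open ≡-Reasoning

  -- A non-loop dart (x,y) lies on the edges {w,v} for v = y if x = w and for
  -- v = x if y = w; summing over v gives its contribution to the degree of w.
  ∑-onEdge : ∀ w x y → x ≢ y → ∑[ v < n ] onEdge G w v (x , y) ≡ (x ≡ᵇ w) xor (y ≡ᵇ w)
  ∑-onEdge w x y x≢y = begin
      ∑[ v < n ] onEdge G w v (x , y)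
    ≡⟨ sum-cong-≗ as-xor ⟩
      ∑[ v < n ] (((x ≡ᵇ w) ∧ (v ≡ᵇ y)) xor ((y ≡ᵇ w) ∧ (v ≡ᵇ x)))
    ≡⟨ ∑-distrib-+ (λ v → (x ≡ᵇ w) ∧ (v ≡ᵇ y)) (λ v → (y ≡ᵇ w) ∧ (v ≡ᵇ x)) ⟩
      ∑[ v < n ] ((x ≡ᵇ w) ∧ (v ≡ᵇ y)) xor ∑[ v < n ] ((y ≡ᵇ w) ∧ (v ≡ᵇ x))
    ≡⟨ cong₂ _xor_ (∑-select (λ _ → x ≡ᵇ w) y) (∑-select (λ _ → y ≡ᵇ w) x) ⟩
      (x ≡ᵇ w) xor (y ≡ᵇ w)
    ∎
    where
    open ≡-Reasoning
    ∨-disjoint : ∀ a b → (a ≡ true → b ≡ true → ⊥) → a ∨ b ≡ a xor b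
    ∨-disjoint true  true  both = ⊥-elim (both refl refl)
    ∨-disjoint true  false _    = refl
    ∨-disjoint false b     _    = refl
    as-xor : ∀ v → onEdge G w v (x , y) ≡ ((x ≡ᵇ w) ∧ (v ≡ᵇ y)) xor ((y ≡ᵇ w) ∧ (v ≡ᵇ x))
    as-xor v = begin
        onEdge G w v (x , y)
      ≡⟨ onEdge-spec w v x y ⟩
        ((x ≡ᵇ w) ∧ (y ≡ᵇ v)) ∨ ((x ≡ᵇ v) ∧ (y ≡ᵇ w))
      ≡⟨ ∨-disjoint _ _ (λ xw∧yv xv∧yw → x≢y (trans (≡ᵇ-sound (∧-true₁ xw∧yv))
                                                     (sym (≡ᵇ-sound (∧-true₂ xv∧yw))))) ⟩
        ((x ≡ᵇ w) ∧ (y ≡ᵇ v)) xor ((x ≡ᵇ v) ∧ (y ≡ᵇ w))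
      ≡⟨ cong₂ _xor_ (cong ((x ≡ᵇ w) ∧_) (≡ᵇ-sym y v))
                     (trans (∧-comm (x ≡ᵇ v) (y ≡ᵇ w)) (cong ((y ≡ᵇ w) ∧_) (≡ᵇ-sym x v))) ⟩
        ((x ≡ᵇ w) ∧ (v ≡ᵇ y)) xor ((y ≡ᵇ w) ∧ (v ≡ᵇ x))
      ∎
      where
      ∧-true₁ : ∀ {a b} → a ∧ b ≡ true → a ≡ true
      ∧-true₁ {true} _ = refl
      ∧-true₂ : ∀ {a b} → a ∧ b ≡ true → b ≡ true
      ∧-true₂ {true} eq = eq

  -- For darts along edges (which are never loops), the degree parity of w in L
  -- is the sum over all v of the parities of the traversals of {w,v}.
  oddDegreeIn-uses : ∀ L → EdgeDarts L → ∀ w → oddDegreeIn L w ≡ ∑[ v < n ] parity (uses G w v L)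
  oddDegreeIn-uses []            []           w = sym (sum-replicate-zero n)
  oddDegreeIn-uses ((x , y) ∷ L) (xy ∷ edges) w = begin
      ((x ≡ᵇ w) xor (y ≡ᵇ w)) xor oddDegreeIn L w
    ≡⟨ cong₂ _xor_ (sym (∑-onEdge w x y (adj⇒≢ xy))) (oddDegreeIn-uses L edges w) ⟩
      ∑[ v < n ] onEdge G w v (x , y) xor ∑[ v < n ] parity (uses G w v L)
    ≡⟨ sym (∑-distrib-+ (λ v → onEdge G w v (x , y)) (λ v → parity (uses G w v L))) ⟩
      ∑[ v < n ] (onEdge G w v (x , y) xor parity (uses G w v L))
    ≡⟨ sum-cong-≗ (λ v → trans (sym (parity-bit+ (onEdge G w v (x , y)) _))
                               (cong parity (sym (uses-∷ w v (x , y) L)))) ⟩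
      ∑[ v < n ] parity (uses G w v ((x , y) ∷ L))
    ∎
    where
    open ≡-Reasoning
    adj⇒≢ : adj G x y ≡ true → x ≢ y
    adj⇒≢ xy refl with () ← trans (sym (irrefl G x)) xy

  oddDegreeIn-once : ∀ L → EachEdgeOnce L → ∀ w → oddDegreeIn L w ≡ oddDegree G w
  oddDegreeIn-once L (edges , once) w =
    trans (oddDegreeIn-uses L edges w) (sum-cong-≗ traversal-parity)
    where
    traversal-parity : ∀ v → parity (uses G w v L) ≡ adj G w v
    traversal-parity v with adj G w v in wv
    ... | true  = cong parity (once w v wv)
    ... | false = cong parity (uses-nonedge w v L edges wv)

  walk-edges : ∀ {a b} L → Walk G a L b → EdgeDarts L
  walk-edges []            _               = []
  walk-edges ((x , y) ∷ L) (_ , xy , walk) = xy ∷ walk-edges L walk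

  eulerian⇒evenDegrees : Eulerian G → ∀ w → oddDegree G w ≡ false
  eulerian⇒evenDegrees (W , inj₁ refl , once) w = sym (oddDegreeIn-once [] ([] , once) w)
  eulerian⇒evenDegrees (W , inj₂ (a , circuit) , once) w = begin
      oddDegree G w
    ≡⟨ sym (oddDegreeIn-once W (walk-edges W circuit , once) w) ⟩
      oddDegreeIn W w
    ≡⟨ walk-oddDegreeIn W circuit w ⟩
      (a ≡ᵇ w) xor (a ≡ᵇ w)
    ≡⟨ xor-same (a ≡ᵇ w) ⟩
      false
    ∎
    where open ≡-Reasoning

filter-unique-one : ∀ {A : Set} {P : A → Set} (P? : Decidable P) {xs : List A} {x : A} →
  Unique xs → x ∈ xs → P x → (∀ {y} → y ∈ xs → P y → y ≡ x) → length (filter P? xs) ≡ 1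
filter-unique-one {P = P} P? {x ∷ ys} (x∉ys ∷ _) (here refl) Px only =
  cong length (trans (filter-accept P? Px) (cong (x ∷_) (filter-none P? (All.tabulate ¬P))))
  where
  ¬P : ∀ {y} → y ∈ ys → ¬ P y
  ¬P y∈ys Py = All.lookup x∉ys y∈ys (sym (only (there y∈ys) Py))
filter-unique-one P? {y ∷ ys} (y∉ys ∷ unique) (there x∈ys) Px only =
  trans (cong length (filter-reject P? (λ Py → All.lookup y∉ys x∈ys (only (here refl) Py))))
        (filter-unique-one P? unique x∈ys Px (only ∘ there))

module _ {n : ℕ} (G : Graph n) where

  -- The darts (x,y) of edges with x of larger index than y: one per edge.
  downward : Dart G → Bool
  downward (x , y) = adj G x y ∧ (toℕ y <ᵇ toℕ x)

  allDarts : List (Dart G)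
  allDarts = cartesianProduct (allFin n) (allFin n)

  edgeList : List (Dart G)
  edgeList = filterᵇ downward allDarts

  edgeList-unique : Unique edgeList
  edgeList-unique = filter⁺ (T? ∘ downward) (cartesianProduct⁺ (allFin⁺ n) (allFin⁺ n))

  edgeList-edges : EdgeDarts G edgeList
  edgeList-edges = All.map (λ down → T⇒≡ (proj₁ (Equivalence.to T-∧ down))) (all-filter (T? ∘ downward) allDarts)
    where
    T⇒≡ : ∀ {b} → T b → b ≡ true
    T⇒≡ {true} _ = refl

  edgeList-downward : ∀ {x y} → (x , y) ∈ edgeList → toℕ y < toℕ x
  edgeList-downward {x} {y} xy∈ =
    <ᵇ⇒< (toℕ y) (toℕ x) (proj₂ (Equivalence.to T-∧ (proj₂ (∈-filter⁻ (T? ∘ downward) {xs = allDarts} xy∈))))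

  edgeList-once-downward : ∀ u v → adj G u v ≡ true → toℕ v < toℕ u → uses G u v edgeList ≡ 1
  edgeList-once-downward u v uv v<u =
    filter-unique-one (λ d → onEdge G u v d ≟ᵇ true) edgeList-unique
      (∈-filter⁺ (T? ∘ downward) (∈-cartesianProduct⁺ (∈-allFin u) (∈-allFin v)) uv-downward)
      (onEdge-self G u v) only-uv
    where
    uv-downward : T (downward (u , v))
    uv-downward rewrite uv = <⇒<ᵇ v<u
    only-uv : ∀ {d} → d ∈ edgeList → onEdge G u v d ≡ true → d ≡ (u , v)
    only-uv {x , y} d∈ on with onEdge-cases G u v x y on
    ... | inj₁ (refl , refl) = refl
    ... | inj₂ (refl , refl) = contradiction v<u (<-asym (edgeList-downward d∈))

  edgeList-once : EachEdgeOnce G edgeList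
  edgeList-once = edgeList-edges , once
    where
    once : ∀ u v → adj G u v ≡ true → uses G u v edgeList ≡ 1
    once u v uv with <-cmp (toℕ v) (toℕ u)
    ... | tri< v<u _ _ = edgeList-once-downward u v uv v<u
    ... | tri≈ _ v≡u _ with () ← trans (sym (irrefl G u)) (subst (λ w → adj G u w ≡ true) (toℕ-injective v≡u) uv)
    ... | tri> _ _ u<v = trans (uses-sym G u v edgeList)
                               (edgeList-once-downward v u (trans (adj-sym G v u) uv) u<v)

module _ {n : ℕ} (G : Graph n) where

  infix 4 _≈ᵉ_
  _≈ᵉ_ : List (Dart G) → List (Dart G) → Set
  L ≈ᵉ M = ∀ u v → uses G u v L ≡ uses G u v M

  Isolated : List (Dart G) → Fin n → Set
  Isolated L v = ∀ u → uses G u v L ≡ 0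

  isolated⇒even : ∀ {L v} → EdgeDarts G L → Isolated L v → oddDegreeIn G L v ≡ false
  isolated⇒even {L} {v} edges iso = begin
      oddDegreeIn G L v
    ≡⟨ oddDegreeIn-uses G L edges v ⟩
      ∑[ u < n ] parity (uses G v u L)
    ≡⟨ sum-cong-≗ (λ u → cong parity (trans (uses-sym G v u L) (iso u))) ⟩
      ∑[ u < n ] false
    ≡⟨ sum-replicate-zero n ⟩
      false
    ∎
    where open ≡-Reasoning

  ≈ᵉ-oddDegreeIn : ∀ {L M} → EdgeDarts G L → EdgeDarts G M → L ≈ᵉ M →
                   ∀ w → oddDegreeIn G L w ≡ oddDegreeIn G M w
  ≈ᵉ-oddDegreeIn {L} {M} edgesL edgesM L≈M w =
    trans (oddDegreeIn-uses G L edgesL w)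
      (trans (sum-cong-≗ (λ v → cong parity (L≈M w v))) (sym (oddDegreeIn-uses G M edgesM w)))

  record Departure (a : Fin n) (L : List (Dart G)) : Set where
    field
      next       : Fin n
      rest       : List (Dart G)
      edge       : adj G a next ≡ true
      rest-edges : EdgeDarts G rest
      one-less   : suc (length rest) ≡ length L
      reordered  : L ≈ᵉ (a , next) ∷ rest

  depart : ∀ a L → EdgeDarts G L → Departure a L ⊎ Isolated L a
  depart a []            []           = inj₂ (λ u → refl)
  depart a ((x , y) ∷ L) (xy ∷ edges) = depart-∷ (x ≟ a) (y ≟ a) (depart a L edges)
    where
    open Departure
    depart-∷ : Dec (x ≡ a) → Dec (y ≡ a) → Departure a L ⊎ Isolated L a →
               Departure a ((x , y) ∷ L) ⊎ Isolated ((x , y) ∷ L) a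
    depart-∷ (yes refl) _ _ = inj₁ record
      { next = y ; rest = L ; edge = xy ; rest-edges = edges ; one-less = refl ; reordered = λ u v → refl }
    depart-∷ (no _) (yes refl) _ = inj₁ record
      { next = x ; rest = L ; edge = trans (adj-sym G a x) xy ; rest-edges = edges ; one-less = refl
      ; reordered = λ u v → trans (uses-∷ G u v (x , a) L)
          (trans (cong (λ b → bit b + uses G u v L) (onEdge-reverse G u v x a)) (sym (uses-∷ G u v (a , x) L))) }
    depart-∷ (no _) (no _) (inj₁ dep) = inj₁ record
      { next = next dep ; rest = (x , y) ∷ rest dep ; edge = edge dep ; rest-edges = xy ∷ rest-edges dep
      ; one-less = cong suc (one-less dep) ; reordered = swap-front }
      where
      swap-front : (x , y) ∷ L ≈ᵉ (a , next dep) ∷ (x , y) ∷ rest dep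
      swap-front u v = begin
          uses G u v ((x , y) ∷ L)
        ≡⟨ trans (uses-∷ G u v (x , y) L)
                 (cong (b₁ +_) (trans (reordered dep u v) (uses-∷ G u v (a , next dep) (rest dep)))) ⟩
          b₁ + (b₂ + uses G u v (rest dep))
        ≡⟨ swap-summands b₁ b₂ (uses G u v (rest dep)) ⟩
          b₂ + (b₁ + uses G u v (rest dep))
        ≡⟨ sym (trans (uses-∷ G u v (a , next dep) _) (cong (b₂ +_) (uses-∷ G u v (x , y) (rest dep)))) ⟩
          uses G u v ((a , next dep) ∷ (x , y) ∷ rest dep)
        ∎
        where
        open ≡-Reasoning
        b₁ = bit (onEdge G u v (x , y))
        b₂ = bit (onEdge G u v (a , next dep))
        swap-summands : ∀ p q r → p + (q + r) ≡ q + (p + r)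
        swap-summands = solve-∀
    depart-∷ (no x≢a) (no y≢a) (inj₂ iso) = inj₂ (λ u →
      trans (uses-∷ G u a (x , y) L) (cong₂ _+_ (cong bit (avoids-a u)) (iso u)))
      where
      avoids-a : ∀ u → onEdge G u a (x , y) ≡ false
      avoids-a u with onEdge G u a (x , y) in on
      ... | false = refl
      ... | true with onEdge-endpoint G a u x y (trans (onEdge-sym G a u (x , y)) on)
      ...   | inj₁ x≡a = contradiction x≡a x≢a
      ...   | inj₂ y≡a = contradiction y≡a y≢a

  Visits : Fin n → List (Dart G) → Fin n → Set
  Visits a W v = v ≡ a ⊎ Any (λ d → proj₁ d ≡ v ⊎ proj₂ d ≡ v) W

  -- The outcome of Hierholzer's procedure on L: a walk from a to b and an
  -- unused remainder with even degrees that avoids every vertex of the walk.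
  record Extraction (a b : Fin n) (L : List (Dart G)) : Set where
    field
      walk            : List (Dart G)
      remainder       : List (Dart G)
      is-walk         : Walk G a walk b
      remainder-edges : EdgeDarts G remainder
      remainder-even  : ∀ w → oddDegreeIn G remainder w ≡ false
      partition       : walk ++ remainder ≈ᵉ L
      no-longer       : length remainder ≤ length L
      avoids          : ∀ v → Visits a walk v → Isolated remainder v

  walk-++ : ∀ {a b c} W₁ W₂ → Walk G a W₁ b → Walk G b W₂ c → Walk G a (W₁ ++ W₂) c
  walk-++ []             W₂ refl                 walk₂ = walk₂
  walk-++ ((x , y) ∷ W₁) W₂ (x≡a , xy , walk₁) walk₂ = x≡a , xy , walk-++ W₁ W₂ walk₁ walk₂

  isolated-shrinks : ∀ W R {L v} → W ++ R ≈ᵉ L → Isolated L v → Isolated R v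
  isolated-shrinks W R W++R≈L iso u =
    m+n≡0⇒n≡0 (uses G u _ W) (trans (sym (uses-++ G u _ W R)) (trans (W++R≈L u _) (iso u)))

  -- If a is isolated, the parity condition forces a = b and the empty walk works.
  stay : ∀ {a b L} → EdgeDarts G L → Isolated L a →
         (∀ w → oddDegreeIn G L w ≡ (a ≡ᵇ w) xor (b ≡ᵇ w)) → Extraction a b L
  stay {a} {b} {L} edges iso odd = record
    { walk = [] ; remainder = L ; is-walk = a≡b ; remainder-edges = edges
    ; remainder-even = λ w → trans (odd w) (trans (cong (λ z → (z ≡ᵇ w) xor (b ≡ᵇ w)) a≡b) (xor-same (b ≡ᵇ w)))
    ; partition = λ u v → refl ; no-longer = ≤-refl
    ; avoids = λ { v (inj₁ refl) → iso } }
    where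
    a≡b : a ≡ b
    a≡b = sym (≡ᵇ-sound (not-injective (begin
        not (b ≡ᵇ a)
      ≡⟨ cong (_xor (b ≡ᵇ a)) (sym (dec-true (a ≟ a) refl)) ⟩
        (a ≡ᵇ a) xor (b ≡ᵇ a)
      ≡⟨ sym (odd a) ⟩
        oddDegreeIn G L a
      ≡⟨ isolated⇒even edges iso ⟩
        false
      ∎)))
      where open ≡-Reasoning

  -- Hierholzer's splice: leave a along the edge {a,x}, walk from x to b in the
  -- rest (W₁), then insert a closed walk at a from the remainder (W₂) in front.
  splice : ∀ {a b L} (dep : Departure a L) →
    (r₁ : Extraction (Departure.next dep) b (Departure.rest dep)) →
    Extraction a a (Extraction.remainder r₁) → Extraction a b L
  splice {a} {b} {L} dep r₁ r₂ = record
    { walk = W₂ ++ (a , x) ∷ W₁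
    ; remainder = R₂
    ; is-walk = walk-++ W₂ ((a , x) ∷ W₁) (is-walk r₂) (refl , edge dep , is-walk r₁)
    ; remainder-edges = remainder-edges r₂
    ; remainder-even = remainder-even r₂
    ; partition = partition′
    ; no-longer = ≤-trans (no-longer r₂) (≤-trans (no-longer r₁)
                    (≤-trans (n≤1+n (length (rest dep))) (≤-reflexive (one-less dep))))
    ; avoids = avoids′
    }
    where
    open Departure
    open Extraction
    x  = next dep
    W₁ = walk r₁
    W₂ = walk r₂
    R₂ = remainder r₂
    partition′ : (W₂ ++ (a , x) ∷ W₁) ++ R₂ ≈ᵉ L
    partition′ u v = begin
        uses G u v ((W₂ ++ (a , x) ∷ W₁) ++ R₂)
      ≡⟨ trans (uses-++ G u v (W₂ ++ (a , x) ∷ W₁) R₂)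
               (cong (_+ uses G u v R₂) (trans (uses-++ G u v W₂ ((a , x) ∷ W₁))
                                              (cong (uses G u v W₂ +_) (uses-∷ G u v (a , x) W₁)))) ⟩
        (uses G u v W₂ + (e + uses G u v W₁)) + uses G u v R₂
      ≡⟨ regroup (uses G u v W₂) e (uses G u v W₁) (uses G u v R₂) ⟩
        e + (uses G u v W₁ + (uses G u v W₂ + uses G u v R₂))
      ≡⟨ cong (λ k → e + (uses G u v W₁ + k)) (trans (sym (uses-++ G u v W₂ R₂)) (partition r₂ u v)) ⟩
        e + (uses G u v W₁ + uses G u v (remainder r₁))
      ≡⟨ cong (e +_) (trans (sym (uses-++ G u v W₁ (remainder r₁))) (partition r₁ u v)) ⟩
        e + uses G u v (rest dep)
      ≡⟨ sym (trans (reordered dep u v) (uses-∷ G u v (a , x) (rest dep))) ⟩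
        uses G u v L
      ∎
      where
      open ≡-Reasoning
      e = bit (onEdge G u v (a , x))
      regroup : ∀ w₂ e w₁ r₂ → (w₂ + (e + w₁)) + r₂ ≡ e + (w₁ + (w₂ + r₂))
      regroup = solve-∀
    shrink : ∀ {v} → Isolated (remainder r₁) v → Isolated R₂ v
    shrink = isolated-shrinks W₂ R₂ {remainder r₁} (partition r₂)
    avoids′ : ∀ v → Visits a (W₂ ++ (a , x) ∷ W₁) v → Isolated R₂ v
    avoids′ v (inj₁ v≡a) = avoids r₂ v (inj₁ v≡a)
    avoids′ v (inj₂ on-walk) with Any.++⁻ W₂ on-walk
    ... | inj₁ on-W₂                 = avoids r₂ v (inj₂ on-W₂)
    ... | inj₂ (here (inj₁ a≡v))     = avoids r₂ v (inj₁ (sym a≡v))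
    ... | inj₂ (here (inj₂ x≡v))     = shrink (avoids r₁ v (inj₁ (sym x≡v)))
    ... | inj₂ (there on-W₁)         = shrink (avoids r₁ v (inj₂ on-W₁))

  -- The bound k on the length drives the recursion.
  extract : ∀ k L → length L ≤ k → EdgeDarts G L → ∀ a b →
    (∀ w → oddDegreeIn G L w ≡ (a ≡ᵇ w) xor (b ≡ᵇ w)) → Extraction a b L
  extract k L bound edges a b odd with depart a L edges
  ... | inj₂ iso = stay edges iso odd
  ... | inj₁ dep with k
  ...   | zero  with () ← ≤-trans (≤-reflexive (Departure.one-less dep)) bound
  ...   | suc k = splice dep r₁ r₂
    where
    open Departure dep
    bound′ : length rest ≤ k
    bound′ = s≤s⁻¹ (≤-trans (≤-reflexive one-less) bound)
    r₁ : Extraction next b rest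
    r₁ = extract k rest bound′ rest-edges next b (λ w →
      xor-cancelˡ (a ≡ᵇ w) (next ≡ᵇ w) (b ≡ᵇ w) (oddDegreeIn G rest w)
        (trans (sym (≈ᵉ-oddDegreeIn edges (edge ∷ rest-edges) reordered w)) (odd w)))
    open Extraction r₁ using (remainder; remainder-edges; remainder-even; no-longer)
    r₂ : Extraction a a remainder
    r₂ = extract k remainder (≤-trans no-longer bound′) remainder-edges a a
           (λ w → trans (remainder-even w) (sym (xor-same (a ≡ᵇ w))))

  traversed⇒visited : ∀ {a} t s W k → uses G t s W ≡ suc k → Visits a W t
  traversed⇒visited t s ((p , q) ∷ W) k traversed with onEdge G t s (p , q) in on
  ... | true  = inj₂ (here (onEdge-endpoint G t s p q on))
  ... | false with traversed⇒visited t s W k traversed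
  ...   | inj₁ t≡a    = inj₁ t≡a
  ...   | inj₂ on-W   = inj₂ (there on-W)

  -- Euler's theorem for edge lists: if L lists every edge once, all degrees
  -- are even and any two edges are connected, then a single closed walk
  -- extracted from L already uses every edge, because its remainder avoids
  -- the walk and hence the whole (unique) non-trivial component.
  circuit : AtMostOneNontrivialComponent G → ∀ L → EachEdgeOnce G L →
            (∀ w → oddDegreeIn G L w ≡ false) → Eulerian G
  circuit connected []            ([] , once)     even = [] , inj₁ refl , once
  circuit connected ((x , y) ∷ L) (edges@(xy ∷ _) , once) even =
    walk , inj₂ (x , is-walk) , traversed-once
    where
    r : Extraction x x ((x , y) ∷ L)
    r = extract (suc (length L)) ((x , y) ∷ L) ≤-refl edges x x
          (λ w → trans (even w) (sym (xor-same (x ≡ᵇ w))))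
    open Extraction r
    -- Edges at a vertex of the walk are traversed by the walk alone.
    on-walk : ∀ u v → Visits x walk v → uses G u v walk ≡ uses G u v ((x , y) ∷ L)
    on-walk u v visited = begin
        uses G u v walk
      ≡⟨ sym (+-identityʳ _) ⟩
        uses G u v walk + 0
      ≡⟨ cong (uses G u v walk +_) (sym (avoids v visited u)) ⟩
        uses G u v walk + uses G u v remainder
      ≡⟨ sym (uses-++ G u v walk remainder) ⟩
        uses G u v (walk ++ remainder)
      ≡⟨ partition u v ⟩
        uses G u v ((x , y) ∷ L)
      ∎
      where open ≡-Reasoning
    -- Hence the walk spreads along edges, and so through the whole component.
    spread : ∀ {s t} → adj G s t ≡ true → Visits x walk s → Visits x walk t
    spread {s} {t} st visited =
      traversed⇒visited t s walk 0 (trans (on-walk t s visited) (once t s (trans (adj-sym G t s) st)))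
    reach : ∀ {s t} → Reachable G s t → Visits x walk s → Visits x walk t
    reach here             visited = visited
    reach (step st s⇝t) visited = reach s⇝t (spread st visited)
    traversed-once : ∀ u v → adj G u v ≡ true → uses G u v walk ≡ 1
    traversed-once u v uv =
      trans (on-walk u v (spread uv (reach (connected x y u v xy uv) (inj₁ refl)))) (once u v uv)

evenDegrees⇒eulerian : ∀ {n} (G : Graph n) → AtMostOneNontrivialComponent G →
  (∀ w → oddDegree G w ≡ false) → Eulerian G
evenDegrees⇒eulerian G connected even =
  circuit G connected (edgeList G) (edgeList-once G)
    (λ w → trans (oddDegreeIn-once G (edgeList G) (edgeList-once G) w) (even w))

corollary3 : (n : ℕ) (G : Graph n) → AtMostOneNontrivialComponent G →
    (Eulerian G → ∀ (π : Permutation′ n) → SumZero G π) × ((∀ (π : Permutation′ n) → SumZero G π) → Eulerian G)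
corollary3 n G connected =
  (λ eulerian → evenDegrees⇒sumZero G (eulerian⇒evenDegrees G eulerian)) ,
  (λ zeroSums → evenDegrees⇒eulerian G connected (sumZero⇒evenDegrees G zeroSums))
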